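{- If a language $L\subseteq A^*$ belongs to $\mathcal B_1$, then $L$ satisfies the ultrafilter equations in the families $\mathcal E_{ab=ba}$, $\mathcal E_{aab=abb}$ and $\mathcal E_{a=a.a}$ for every $a,b\in A$.
   Context: $A$ is a finite alphabet. For $a\in A$, $c_a(w):=\{i<|w|: w_i=a\}$; $\mathcal B_1$ is the Boolean subalgebra of $\mathcal P(A^*)$ generated by the languages $\{w: c_a(w)\cap Q\neq\emptyset\}$, $a\in A$, $Q\subseteq\mathbb N$. $\beta(S)$ is the set of ultrafilters on $S$, $\beta f(\nu):=\{P: f^{ -1}(P)\in\nu\}$; $L$ satisfies $\gamma_1\leftrightarrow\gamma_2$ iff ($L\in\gamma_1\iff L\in\gamma_2$). $A^*\otimes\mathbb N^n:=\{(w,j_1,\dots,j_n): j_m<|w|\}$. For $p_1,\dots,p_n:D\to\mathbb N$, $u,v:D\to A^*$ on $D=A^*\otimes\mathbb N^n$, $\mathcal E^{p_1,\dots,p_n}_{u=v}$ is the family of equations $\beta u(\nu)\leftrightarrow\beta v(\nu)$ for $\nu\in\beta(D)$ with $\beta p_1(\nu)=\dots=\beta p_n(\nu)$. $w((j_1,\dots,j_m)\to(b_1,\dots,b_m))$ replaces the letter at $j_r$ by $b_r$. $f_{a,b}(w,j_1,j_2):=w((j_1,j_2)\to(a,b))$ if $j_1\neq j_2$, else $w$; $f_{a,a,b}(w,j_1,j_2,j_3):=w((j_1,j_2,j_3)\to(a,a,b))$ if pairwise distinct, else $w$ (similarly $f_{a,b,b}$); $f_a(w,i):=w(i\to a)$,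 $(f_a.a)(w,i):=w(i\to a)\,a$. $\mathcal E_{ab=ba}:=\mathcal E^{\pi_1,\pi_2}_{f_{a,b}=f_{b,a}}$, $\mathcal E_{aab=abb}:=\mathcal E^{\pi_1,\pi_2,\pi_3}_{f_{a,a,b}=f_{a,b,b}}$, $\mathcal E_{a=a.a}:=\mathcal E^{\pi,|\cdot|}_{f_a=f_a.a}$, where $\pi_r$ are coordinate projections, $\pi(w,i)=i$, $|\cdot|(w,i)=|w|$. -}

module Defs where

open import Data.Nat using (ℕ; zero; suc)
open import Data.Bool using (Bool; true; false; _∧_; _∨_; not)
open import Data.Fin as Fin using (Fin; toℕ)
open import Data.List using (List; []; _∷_; length; _++_; [_])
open import Data.Vec using (Vec; lookup)
open import Data.Product using (Σ; _×_; _,_; proj₁; proj₂)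
open import Data.Unit using (⊤)
open import Data.Sum using (_⊎_)
open import Relation.Nullary using (¬_; does)
open import Relation.Binary.PropositionalEquality using (_≡_)
open import Function.Bundles using (_⇔_)

Subset : Set → Set
Subset S = S → Bool

record IsUltrafilter {S : Set} (ν : Subset S → Set) : Set₁ where
  field
    upward : ∀ (P Q : Subset S) → (∀ x → P x ≡ true → Q x ≡ true) → ν P → ν Q
    inter  : ∀ (P Q : Subset S) → ν P → ν Q → ν (λ x → P x ∧ Q x)
    full   : ν (λ _ → true)
    proper : ¬ ν (λ _ → false)
    ultra  : ∀ (P : Subset S) → ν P ⊎ ν (λ x → not (P x))

β : {S T : Set} → (S → T) → (Subset S → Set) → (Subset T → Set)
β f ν P = ν (λ x → P (f x))

SameUF : {T : Set} → (Subset T → Set) → (Subset T → Set) → Set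
SameUF μ μ' = ∀ P → μ P ⇔ μ' P

AllSame : {D : Set} → (Subset D → Set) → List (D → ℕ) → Set
AllSame ν [] = ⊤
AllSame ν (p ∷ []) = ⊤
AllSame ν (p ∷ q ∷ ps) = SameUF (β p ν) (β q ν) × AllSame ν (q ∷ ps)

Satisfies : {A D : Set} → List (D → ℕ) → (D → List A) → (D → List A) → Subset (List A) → Set₁
Satisfies {A} {D} ps u v L =
  ∀ (ν : Subset D → Set) → IsUltrafilter ν → AllSame ν ps → β u ν L ⇔ β v ν L

module _ {k : ℕ} where
  Word : Set
  Word = List (Fin k)

  -- A* ⊗ ℕⁿ : words with n positions j_m < |w|
  Dom : ℕ → Set
  Dom n = Σ Word (λ w → Vec (Fin (length w)) n)

  proj : {n : ℕ} → Fin n → Dom n → ℕ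
  proj r (w , js) = toℕ (lookup js r)

  len : {n : ℕ} → Dom n → ℕ
  len (w , _) = length w

  -- replace the letter at position i (no-op if out of range)
  setAt : Word → ℕ → Fin k → Word
  setAt [] i b = []
  setAt (x ∷ xs) zero b = b ∷ xs
  setAt (x ∷ xs) (suc i) b = x ∷ setAt xs i b

  distinct? : {m : ℕ} → Fin m → Fin m → Bool
  distinct? i j = not (does (i Fin.≟ j))

  i0 : Fin 3
  i0 = Fin.zero
  i1 : Fin 3
  i1 = Fin.suc Fin.zero
  i2 : Fin 3
  i2 = Fin.suc (Fin.suc Fin.zero)

  f2 : Fin k → Fin k → Dom 2 → Word
  f2 a b (w , js) with distinct? (lookup js Fin.zero) (lookup js (Fin.suc Fin.zero))
  ... | true  = setAt (setAt w (toℕ (lookup js Fin.zero)) a) (toℕ (lookup js (Fin.suc Fin.zero))) b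
  ... | false = w

  f3 : Fin k → Fin k → Fin k → Dom 3 → Word
  f3 a b c (w , js) with distinct? (lookup js i0) (lookup js i1) ∧ distinct? (lookup js i0) (lookup js i2) ∧ distinct? (lookup js i1) (lookup js i2)
  ... | true  = setAt (setAt (setAt w (toℕ (lookup js i0)) a) (toℕ (lookup js i1)) b) (toℕ (lookup js i2)) c
  ... | false = w

  f1 : Fin k → Dom 1 → Word
  f1 a (w , js) = setAt w (toℕ (lookup js Fin.zero)) a

  f1a : Fin k → Dom 1 → Word
  f1a a d = f1 a d ++ [ a ]

  occursAt : Fin k → Subset ℕ → ℕ → Word → Bool
  occursAt a Q i [] = false
  occursAt a Q i (x ∷ xs) = (does (x Fin.≟ a) ∧ Q i) ∨ occursAt a Q (suc i) xs

  Gen : Fin k → Subset ℕ → Subset Word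
  Gen a Q = occursAt a Q 0

  data B₁ : Subset Word → Set where
    gen  : ∀ a Q → B₁ (Gen a Q)
    top  : B₁ (λ _ → true)
    compl : ∀ {L} → B₁ L → B₁ (λ w → not (L w))
    meet : ∀ {L L'} → B₁ L → B₁ L' → B₁ (λ w → L w ∧ L' w)
    join : ∀ {L L'} → B₁ L → B₁ L' → B₁ (λ w → L w ∨ L' w)
    ext  : ∀ {L L'} → B₁ L → (∀ w → L w ≡ L' w) → B₁ L'

  E-ab=ba : Fin k → Fin k → Subset Word → Set₁
  E-ab=ba a b = Satisfies (proj Fin.zero ∷ proj (Fin.suc Fin.zero) ∷ []) (f2 a b) (f2 b a)

  E-aab=abb : Fin k → Fin k → Subset Word → Set₁
  E-aab=abb a b = Satisfies (proj i0 ∷ proj i1 ∷ proj i2 ∷ []) (f3 a a b) (f3 a b b)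

  E-a=aa : Fin k → Subset Word → Set₁
  E-a=aa a = Satisfies (proj Fin.zero ∷ len ∷ []) (f1 a) (f1a a)

{-# OPTIONS --safe #-}
-- If β p₁ ν = ⋯ = β pₙ ν, then for ν-almost every d the numbers pᵢ(d) are either all in Q
-- or all outside it. The two sides of each equation write the same set of letters at the
-- positions jᵢ (for a = a.a also at the new position |w|, which is in Q exactly when j₁ is),
-- so Gen c Q takes the same value on both sides there. Membership in an ultrafilter
-- commutes with the Boolean operations, which carries the agreement from the generators
-- to all of B₁.
module Submission where

open import Defs
open import Data.Nat using (ℕ)
open import Data.Fin using (Fin)
open import Data.Product using (_×_)

open import Data.Bool using (Bool; true; false; _∧_; _∨_; not)
open import Data.Bool.Properties
  using (∨-assoc; ∨-comm; ∨-idem; ∨-identityʳ; ∨-zeroʳ; ∧-zeroʳ; ∧-inverseˡ; ∧-conicalˡ; ∧-conicalʳ; not-injective;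
         not-¬; ∨-commutativeMonoid)
open import Data.Fin as Fin using (toℕ)
open import Data.Fin.Properties using (toℕ<n; toℕ-injective)
open import Data.List using ([]; _∷_; length; _++_; [_])
open import Data.Nat as ℕ using (zero; suc; _<_; s≤s; _≡ᵇ_)
open import Data.Product using (∃-syntax; _,_; uncurry)
open import Data.Product.Function.NonDependent.Propositional using (_×-cong_)
open import Data.Sum as Sum using (_⊎_; inj₁; inj₂; fromInj₂)
open import Data.Sum.Function.Propositional using (_⊎-cong_)
open import Data.Vec using (lookup)
open import Function using (_∘_; id)
open import Function.Bundles using (_⇔_; mk⇔; Equivalence)
open import Function.Construct.Composition using (_⇔-∘_)
open import Function.Construct.Symmetry using (⇔-sym)
open import Function.Related.TypeIsomorphisms using (¬-cong-⇔)
open import Relation.Nullary using (¬_; does; contradiction)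
open import Relation.Nullary.Decidable using (dec-true; dec-false)
open import Relation.Binary.PropositionalEquality
  using (_≡_; _≢_; refl; sym; trans; cong; cong₂; subst; module ≡-Reasoning)
open ≡-Reasoning
open import Algebra.Bundles using (CommutativeMonoid)
open import Algebra.Properties.CommutativeSemigroup
  (CommutativeMonoid.commutativeSemigroup ∨-commutativeMonoid) using (x∙yz≈y∙xz)

Almost : {D : Set} → (Subset D → Set) → (D → Set) → Set
Almost ν Φ = ∃[ S ] ν S × (∀ x → S x ≡ true → Φ x)

almost-map : ∀ {D} {ν : Subset D → Set} {Φ Ψ : D → Set} →
  (∀ x → Φ x → Ψ x) → Almost ν Φ → Almost ν Ψ
almost-map Φ⇒Ψ (S , νS , S⇒Φ) = S , νS , λ x Sx → Φ⇒Ψ x (S⇒Φ x Sx)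

module UltrafilterProperties {D : Set} {ν : Subset D → Set} (uf : IsUltrafilter ν) where
  open IsUltrafilter uf

  ν-cong : {P R : Subset D} → (∀ x → P x ≡ R x) → ν P → ν R
  ν-cong P≗R = upward _ _ (λ x Px → trans (sym (P≗R x)) Px)

  ν-∧ : {P R : Subset D} → ν (λ x → P x ∧ R x) ⇔ (ν P × ν R)
  ν-∧ {P} {R} = mk⇔
    (λ νP∧R → upward _ P (λ x → ∧-conicalˡ _ _) νP∧R , upward _ R (λ x → ∧-conicalʳ (P x) _) νP∧R)
    (λ (νP , νR) → inter P R νP νR)

  ν-not : {P : Subset D} → ν (λ x → not (P x)) ⇔ (¬ ν P)
  ν-not {P} = mk⇔
    (λ ν¬P νP → proper (upward _ _ (λ x → trans (sym (∧-inverseˡ (P x)))) (inter _ _ ν¬P νP)))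
    (λ ¬νP → fromInj₂ (λ νP → contradiction νP ¬νP) (ultra P))

  ν-∨ : {P R : Subset D} → ν (λ x → P x ∨ R x) ⇔ (ν P ⊎ ν R)
  ν-∨ {P} {R} = mk⇔ split
    Sum.[ upward P _ (λ x Px → cong (_∨ R x) Px)
    , upward R _ (λ x Rx → trans (cong (P x ∨_) Rx) (∨-zeroʳ (P x))) ]
    where
    not-x∧[x∨y]⇒y : ∀ x y → not x ∧ (x ∨ y) ≡ true → y ≡ true
    not-x∧[x∨y]⇒y false y = id
    not-x∧[x∨y]⇒y true y ()

    split : ν (λ x → P x ∨ R x) → ν P ⊎ ν R
    split νP∨R with ultra P
    ... | inj₁ νP  = inj₁ νP
    ... | inj₂ ν¬P = inj₂ (upward _ R (λ x → not-x∧[x∨y]⇒y (P x) (R x)) (inter _ _ ν¬P νP∨R))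

  almost-× : {Φ Ψ : D → Set} → Almost ν Φ → Almost ν Ψ → Almost ν (λ x → Φ x × Ψ x)
  almost-× (S , νS , S⇒Φ) (T , νT , T⇒Ψ) =
    _ , inter S T νS νT , λ x S∧T → S⇒Φ x (∧-conicalˡ _ _ S∧T) , T⇒Ψ x (∧-conicalʳ (S x) _ S∧T)

  ν-almost-cong : {P R : Subset D} → Almost ν (λ x → P x ≡ R x) → ν P ⇔ ν R
  ν-almost-cong P≈R = mk⇔ (transport P≈R) (transport (almost-map (λ _ → sym) P≈R))
    where
    transport : {P R : Subset D} → Almost ν (λ x → P x ≡ R x) → ν P → ν R
    transport {P} {R} (S , νS , S⇒P≡R) νP =
      upward _ R (λ x S∧P → trans (sym (S⇒P≡R x (∧-conicalˡ _ _ S∧P))) (∧-conicalʳ (S x) _ S∧P))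
        (inter S P νS νP)

  -- Either Q ∘ p or its complement belongs to ν, and β p ν = β q ν carries it over to Q ∘ q.
  sameUF⇒almost : {T : Set} {p q : D → T} → SameUF (β p ν) (β q ν) →
    (Q : Subset T) → Almost ν (λ x → Q (p x) ≡ Q (q x))
  sameUF⇒almost {p = p} p~q Q with ultra (Q ∘ p)
  ... | inj₁ νQp =
    _ , inter _ _ νQp (Equivalence.to (p~q Q) νQp) ,
    λ x both → trans (∧-conicalˡ _ _ both) (sym (∧-conicalʳ (Q (p x)) _ both))
  ... | inj₂ ν¬Qp =
    _ , inter _ _ ν¬Qp (Equivalence.to (p~q (not ∘ Q)) ν¬Qp) ,
    λ x both → not-injective (trans (∧-conicalˡ _ _ both) (sym (∧-conicalʳ (not (Q (p x))) _ both)))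

  β-agree-B₁ : ∀ {k} (u v : D → Word {k}) →
    (∀ c Q → β u ν (Gen c Q) ⇔ β v ν (Gen c Q)) →
    {L : Subset Word} → B₁ L → β u ν L ⇔ β v ν L
  β-agree-B₁ u v onGen (gen c Q) = onGen c Q
  β-agree-B₁ u v onGen top = mk⇔ id id
  β-agree-B₁ u v onGen (compl L) =
    ⇔-sym ν-not ⇔-∘ (¬-cong-⇔ (β-agree-B₁ u v onGen L) ⇔-∘ ν-not)
  β-agree-B₁ u v onGen (meet L L′) =
    ⇔-sym ν-∧ ⇔-∘ ((β-agree-B₁ u v onGen L ×-cong β-agree-B₁ u v onGen L′) ⇔-∘ ν-∧)
  β-agree-B₁ u v onGen (join L L′) =
    ⇔-sym ν-∨ ⇔-∘ ((β-agree-B₁ u v onGen L ⊎-cong β-agree-B₁ u v onGen L′) ⇔-∘ ν-∨)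
  β-agree-B₁ u v onGen (ext L L≗L′) = mk⇔
    (ν-cong (L≗L′ ∘ v) ∘ Equivalence.to   (β-agree-B₁ u v onGen L) ∘ ν-cong (sym ∘ L≗L′ ∘ u))
    (ν-cong (L≗L′ ∘ u) ∘ Equivalence.from (β-agree-B₁ u v onGen L) ∘ ν-cong (sym ∘ L≗L′ ∘ v))

x∨[x∨y]≡x∨y : ∀ x y → x ∨ (x ∨ y) ≡ x ∨ y
x∨[x∨y]≡x∨y x y = trans (sym (∨-assoc x x y)) (cong (_∨ y) (∨-idem x))

infixl 5 _∖_

-- Testing the position first makes (Q ∖ suc n) 0 reduce to Q 0 and (Q ∖ suc n) ∘ suc to
-- (Q ∘ suc) ∖ n; the proof of Gen-setAt relies on both.
_∖_ : Subset ℕ → ℕ → Subset ℕ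
(Q ∖ n) m = not (m ≡ᵇ n) ∧ Q m

∖-≢ : (Q : Subset ℕ) {m n : ℕ} → m ≢ n → (Q ∖ n) m ≡ Q m
∖-≢ Q {m} {n} m≢n = cong (λ b → not b ∧ Q m) (dec-false (m ℕ.≟ n) m≢n)

module _ {k : ℕ} where

  length-setAt : ∀ (w : Word {k}) n x → length (setAt w n x) ≡ length w
  length-setAt []      n       x = refl
  length-setAt (y ∷ w) zero    x = refl
  length-setAt (y ∷ w) (suc n) x = cong suc (length-setAt w n x)

  <-length-setAt : ∀ {m} (w : Word {k}) n x → m < length w → m < length (setAt w n x)
  <-length-setAt w n x m<∣w∣ = subst (_ <_) (sym (length-setAt w n x)) m<∣w∣

  occursAt-suc : ∀ (c : Fin k) Q i w → occursAt c Q (suc i) w ≡ occursAt c (Q ∘ suc) i w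
  occursAt-suc c Q i []      = refl
  occursAt-suc c Q i (x ∷ w) = cong (_ ∨_) (occursAt-suc c Q (suc i) w)

  Gen-∷ : ∀ (c : Fin k) Q x w → Gen c Q (x ∷ w) ≡ (does (x Fin.≟ c) ∧ Q 0) ∨ Gen c (Q ∘ suc) w
  Gen-∷ c Q x w = cong (_ ∨_) (occursAt-suc c Q 0 w)

  Gen-setAt : ∀ (c : Fin k) Q w {n} x → n < length w →
    Gen c Q (setAt w n x) ≡ (does (x Fin.≟ c) ∧ Q n) ∨ Gen c (Q ∖ n) w
  Gen-setAt c Q (y ∷ w) {zero} x _ = trans (Gen-∷ c Q x w) (cong (_ ∨_) (sym dropHead))
    where
    dropHead : Gen c (Q ∖ 0) (y ∷ w) ≡ Gen c (Q ∘ suc) w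
    dropHead = trans (Gen-∷ c (Q ∖ 0) y w) (cong (_∨ _) (∧-zeroʳ (does (y Fin.≟ c))))
  Gen-setAt c Q (y ∷ w) {suc n} x (s≤s n<∣w∣) = begin
    Gen c Q (y ∷ setAt w n x)                 ≡⟨ Gen-∷ c Q y (setAt w n x) ⟩
    old ∨ Gen c (Q ∘ suc) (setAt w n x)       ≡⟨ cong (old ∨_) (Gen-setAt c (Q ∘ suc) w x n<∣w∣) ⟩
    old ∨ (new ∨ Gen c (Q ∘ suc ∖ n) w)       ≡⟨ x∙yz≈y∙xz old new _ ⟩
    new ∨ (old ∨ Gen c (Q ∘ suc ∖ n) w)       ≡⟨ cong (new ∨_) (Gen-∷ c (Q ∖ suc n) y w) ⟨
    new ∨ Gen c (Q ∖ suc n) (y ∷ w)           ∎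
    where
    old new : Bool
    old = does (y Fin.≟ c) ∧ Q 0
    new = does (x Fin.≟ c) ∧ Q (suc n)

  Gen-snoc : ∀ (c : Fin k) Q w x →
    Gen c Q (w ++ [ x ]) ≡ Gen c Q w ∨ (does (x Fin.≟ c) ∧ Q (length w))
  Gen-snoc c Q []      x = ∨-identityʳ _
  Gen-snoc c Q (y ∷ w) x = begin
    Gen c Q (y ∷ w ++ [ x ])                  ≡⟨ Gen-∷ c Q y (w ++ [ x ]) ⟩
    old ∨ Gen c (Q ∘ suc) (w ++ [ x ])        ≡⟨ cong (old ∨_) (Gen-snoc c (Q ∘ suc) w x) ⟩
    old ∨ (Gen c (Q ∘ suc) w ∨ new)           ≡⟨ ∨-assoc old _ new ⟨
    (old ∨ Gen c (Q ∘ suc) w) ∨ new           ≡⟨ cong (_∨ new) (Gen-∷ c Q y w) ⟨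
    Gen c Q (y ∷ w) ∨ new                     ∎
    where
    old new : Bool
    old = does (y Fin.≟ c) ∧ Q 0
    new = does (x Fin.≟ c) ∧ Q (suc (length w))

  Gen-setAt₂ : ∀ (c : Fin k) Q w {n₁ n₂} x y → n₁ ≢ n₂ → n₁ < length w → n₂ < length w →
    Gen c Q (setAt (setAt w n₁ x) n₂ y)
      ≡ (does (y Fin.≟ c) ∧ Q n₂) ∨ ((does (x Fin.≟ c) ∧ Q n₁) ∨ Gen c (Q ∖ n₂ ∖ n₁) w)
  Gen-setAt₂ c Q w {n₁} {n₂} x y n₁≢n₂ n₁<∣w∣ n₂<∣w∣ = begin
    Gen c Q (setAt (setAt w n₁ x) n₂ y)
      ≡⟨ Gen-setAt c Q (setAt w n₁ x) y (<-length-setAt w n₁ x n₂<∣w∣) ⟩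
    Y ∨ Gen c (Q ∖ n₂) (setAt w n₁ x)
      ≡⟨ cong (Y ∨_) (Gen-setAt c (Q ∖ n₂) w x n₁<∣w∣) ⟩
    Y ∨ ((does (x Fin.≟ c) ∧ (Q ∖ n₂) n₁) ∨ Gen c (Q ∖ n₂ ∖ n₁) w)
      ≡⟨ cong (λ b → Y ∨ ((does (x Fin.≟ c) ∧ b) ∨ Gen c (Q ∖ n₂ ∖ n₁) w)) (∖-≢ Q n₁≢n₂) ⟩
    Y ∨ ((does (x Fin.≟ c) ∧ Q n₁) ∨ Gen c (Q ∖ n₂ ∖ n₁) w) ∎
    where
    Y : Bool
    Y = does (y Fin.≟ c) ∧ Q n₂

  Gen-setAt₃ : ∀ (c : Fin k) Q w {n₁ n₂ n₃} x y z → n₁ ≢ n₂ → n₁ ≢ n₃ → n₂ ≢ n₃ →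
    n₁ < length w → n₂ < length w → n₃ < length w →
    Gen c Q (setAt (setAt (setAt w n₁ x) n₂ y) n₃ z)
      ≡ (does (z Fin.≟ c) ∧ Q n₃) ∨ ((does (y Fin.≟ c) ∧ Q n₂) ∨
          ((does (x Fin.≟ c) ∧ Q n₁) ∨ Gen c (Q ∖ n₃ ∖ n₂ ∖ n₁) w))
  Gen-setAt₃ c Q w {n₁} {n₂} {n₃} x y z n₁≢n₂ n₁≢n₃ n₂≢n₃ n₁<∣w∣ n₂<∣w∣ n₃<∣w∣ = begin
    Gen c Q (setAt (setAt (setAt w n₁ x) n₂ y) n₃ z)
      ≡⟨ Gen-setAt c Q (setAt (setAt w n₁ x) n₂ y) z
           (<-length-setAt (setAt w n₁ x) n₂ y (<-length-setAt w n₁ x n₃<∣w∣)) ⟩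
    Z ∨ Gen c (Q ∖ n₃) (setAt (setAt w n₁ x) n₂ y)
      ≡⟨ cong (Z ∨_) (Gen-setAt₂ c (Q ∖ n₃) w x y n₁≢n₂ n₁<∣w∣ n₂<∣w∣) ⟩
    Z ∨ ((does (y Fin.≟ c) ∧ (Q ∖ n₃) n₂) ∨ ((does (x Fin.≟ c) ∧ (Q ∖ n₃) n₁) ∨ R))
      ≡⟨ cong₂ (λ b₂ b₁ → Z ∨ ((does (y Fin.≟ c) ∧ b₂) ∨ ((does (x Fin.≟ c) ∧ b₁) ∨ R)))
           (∖-≢ Q n₂≢n₃) (∖-≢ Q n₁≢n₃) ⟩
    Z ∨ ((does (y Fin.≟ c) ∧ Q n₂) ∨ ((does (x Fin.≟ c) ∧ Q n₁) ∨ R)) ∎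
    where
    Z R : Bool
    Z = does (z Fin.≟ c) ∧ Q n₃
    R = Gen c (Q ∖ n₃ ∖ n₂ ∖ n₁) w

  distinct⇒toℕ-≢ : ∀ {m} {i j : Fin m} → distinct? {k} i j ≡ true → toℕ i ≢ toℕ j
  distinct⇒toℕ-≢ {i = i} {j} i≠j i≡j =
    not-¬ (sym (dec-true (i Fin.≟ j) (toℕ-injective i≡j))) (sym i≠j)

  Gen-ab=ba : ∀ (a b c : Fin k) Q (d : Dom 2) →
    Q (proj Fin.zero d) ≡ Q (proj (Fin.suc Fin.zero) d) → Gen c Q (f2 a b d) ≡ Gen c Q (f2 b a d)
  Gen-ab=ba a b c Q (w , js) Q₁≡Q₂
    with distinct? {k} (lookup js Fin.zero) (lookup js (Fin.suc Fin.zero)) in j₁≠j₂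
  ... | false = refl
  ... | true = begin
    Gen c Q (setAt (setAt w n₁ a) n₂ b)  ≡⟨ Gen-setAt₂ c Q w a b n₁≢n₂ (toℕ<n _) (toℕ<n _) ⟩
    _                                    ≡⟨ swap (does (a Fin.≟ c)) (does (b Fin.≟ c)) (Gen c (Q ∖ n₂ ∖ n₁) w) Q₁≡Q₂ ⟩
    _                                    ≡⟨ Gen-setAt₂ c Q w b a n₁≢n₂ (toℕ<n _) (toℕ<n _) ⟨
    Gen c Q (setAt (setAt w n₁ b) n₂ a)  ∎
    where
    n₁ n₂ : ℕ
    n₁ = toℕ (lookup js Fin.zero)
    n₂ = toℕ (lookup js (Fin.suc Fin.zero))
    n₁≢n₂ : n₁ ≢ n₂
    n₁≢n₂ = distinct⇒toℕ-≢ j₁≠j₂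
    swap : ∀ {q₁ q₂} x y r → q₁ ≡ q₂ → (y ∧ q₂) ∨ ((x ∧ q₁) ∨ r) ≡ (x ∧ q₂) ∨ ((y ∧ q₁) ∨ r)
    swap x y r refl = x∙yz≈y∙xz (y ∧ _) (x ∧ _) r

  Gen-aab=abb : ∀ (a b c : Fin k) Q (d : Dom 3) →
    Q (proj (i0 {k}) d) ≡ Q (proj (i1 {k}) d) → Q (proj (i1 {k}) d) ≡ Q (proj (i2 {k}) d) →
    Gen c Q (f3 a a b d) ≡ Gen c Q (f3 a b b d)
  Gen-aab=abb a b c Q (w , js) Q₁≡Q₂ Q₂≡Q₃
    with distinct? {k} (lookup js (i0 {k})) (lookup js (i1 {k}))
       ∧ distinct? {k} (lookup js (i0 {k})) (lookup js (i2 {k}))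
       ∧ distinct? {k} (lookup js (i1 {k})) (lookup js (i2 {k})) in pairwise
  ... | false = refl
  ... | true = begin
    Gen c Q (setAt (setAt (setAt w n₁ a) n₂ a) n₃ b)  ≡⟨ Gen-setAt₃ c Q w a a b n₁≢n₂ n₁≢n₃ n₂≢n₃ j₁< j₂< j₃< ⟩
    _                                                 ≡⟨ aab≡abb A B (Gen c (Q ∖ n₃ ∖ n₂ ∖ n₁) w) Q₁≡Q₂ Q₂≡Q₃ ⟩
    _                                                 ≡⟨ Gen-setAt₃ c Q w a b b n₁≢n₂ n₁≢n₃ n₂≢n₃ j₁< j₂< j₃< ⟨
    Gen c Q (setAt (setAt (setAt w n₁ a) n₂ b) n₃ b)  ∎
    where
    n₁ n₂ n₃ : ℕ
    n₁ = toℕ (lookup js (i0 {k}))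
    n₂ = toℕ (lookup js (i1 {k}))
    n₃ = toℕ (lookup js (i2 {k}))
    j₁< : n₁ < length w
    j₁< = toℕ<n _
    j₂< : n₂ < length w
    j₂< = toℕ<n _
    j₃< : n₃ < length w
    j₃< = toℕ<n _
    d₁₂ d₁₃ d₂₃ : Bool
    d₁₂ = distinct? {k} (lookup js (i0 {k})) (lookup js (i1 {k}))
    d₁₃ = distinct? {k} (lookup js (i0 {k})) (lookup js (i2 {k}))
    d₂₃ = distinct? {k} (lookup js (i1 {k})) (lookup js (i2 {k}))
    n₁≢n₂ : n₁ ≢ n₂
    n₁≢n₂ = distinct⇒toℕ-≢ (∧-conicalˡ d₁₂ _ pairwise)
    n₁≢n₃ : n₁ ≢ n₃
    n₁≢n₃ = distinct⇒toℕ-≢ (∧-conicalˡ d₁₃ d₂₃ (∧-conicalʳ d₁₂ _ pairwise))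
    n₂≢n₃ : n₂ ≢ n₃
    n₂≢n₃ = distinct⇒toℕ-≢ (∧-conicalʳ d₁₃ d₂₃ (∧-conicalʳ d₁₂ _ pairwise))
    A B : Bool
    A = does (a Fin.≟ c)
    B = does (b Fin.≟ c)
    aab≡abb : ∀ {q₁ q₂ q₃} x y r → q₁ ≡ q₂ → q₂ ≡ q₃ →
      (y ∧ q₃) ∨ ((x ∧ q₂) ∨ ((x ∧ q₁) ∨ r)) ≡ (y ∧ q₃) ∨ ((y ∧ q₂) ∨ ((x ∧ q₁) ∨ r))
    aab≡abb x y r refl refl =
      trans (cong ((y ∧ _) ∨_) (x∨[x∨y]≡x∨y (x ∧ _) r)) (sym (x∨[x∨y]≡x∨y (y ∧ _) _))

  Gen-a=aa : ∀ (a c : Fin k) Q (d : Dom 1) →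
    Q (proj Fin.zero d) ≡ Q (len d) → Gen c Q (f1 a d) ≡ Gen c Q (f1a a d)
  Gen-a=aa a c Q (w , js) Qj≡Q∣w∣ = sym (begin
    Gen c Q (setAt w j a ++ [ a ])
      ≡⟨ Gen-snoc c Q (setAt w j a) a ⟩
    Gen c Q (setAt w j a) ∨ (A ∧ Q (length (setAt w j a)))
      ≡⟨ cong₂ _∨_ (Gen-setAt c Q w a (toℕ<n _))
                   (cong (λ m → A ∧ Q m) (length-setAt w j a)) ⟩
    ((A ∧ Q j) ∨ Gen c (Q ∖ j) w) ∨ (A ∧ Q (length w))
      ≡⟨ cong (λ q → ((A ∧ Q j) ∨ Gen c (Q ∖ j) w) ∨ (A ∧ q)) Qj≡Q∣w∣ ⟨
    ((A ∧ Q j) ∨ Gen c (Q ∖ j) w) ∨ (A ∧ Q j)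
      ≡⟨ trans (∨-comm _ (A ∧ Q j)) (x∨[x∨y]≡x∨y (A ∧ Q j) _) ⟩
    (A ∧ Q j) ∨ Gen c (Q ∖ j) w
      ≡⟨ Gen-setAt c Q w a (toℕ<n _) ⟨
    Gen c Q (setAt w j a) ∎)
    where
    j : ℕ
    j = toℕ (lookup js Fin.zero)
    A : Bool
    A = does (a Fin.≟ c)

mainTheorem14 : ∀ {k : ℕ} (L : Subset (Word {k})) → B₁ L →
    ∀ (a b : Fin k) → E-ab=ba a b L × E-aab=abb a b L × E-a=aa a L
mainTheorem14 L L∈B₁ a b =
    (λ ν uf (p₁~p₂ , _) → β-agree-B₁ uf _ _ (λ c Q → ν-almost-cong uf
       (almost-map (Gen-ab=ba a b c Q) (sameUF⇒almost uf p₁~p₂ Q))) L∈B₁)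
  , (λ ν uf (p₁~p₂ , p₂~p₃ , _) → β-agree-B₁ uf _ _ (λ c Q → ν-almost-cong uf
       (almost-map (λ d → uncurry (Gen-aab=abb a b c Q d))
         (almost-× uf (sameUF⇒almost uf p₁~p₂ Q) (sameUF⇒almost uf p₂~p₃ Q)))) L∈B₁)
  , (λ ν uf (p~len , _) → β-agree-B₁ uf _ _ (λ c Q → ν-almost-cong uf
       (almost-map (Gen-a=aa a c Q) (sameUF⇒almost uf p~len Q))) L∈B₁)
  where open UltrafilterProperties
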